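{- Let $n\ge 0$ and $k\ge n+1$ be integers. Let $U$ consist of the set $\{x_1,x_2,\dots,x_{k+1}\}$ together with all sets $\{x_{i_0},x_{i_1},\dots,x_{i_n},y\}$ where $x_{i_0},\dots,x_{i_n}$ are $n+1$ distinct elements of $\{x_1,\dots,x_{k+1}\}$, with $x_1,\dots,x_{k+1}$ Left vertices and $y$ a Right vertex. Let $G$ be an SP-game whose legal complex $\Delta_G$ has as facets the elements of $U$. Then $\Delta_G$ has dimension $k$ and $G$ has value $n$.
   Context: Games are two-player (Left, Right) short combinatorial games under normal play; value means game value (equivalence class under $G=H$ iff $G-H$ is a second-player win). An SP-game is a placement game on an initially empty board in which pieces are never moved or removed and in which any sequence of moves leading to a reachable position consists of legal moves. Its legal complex $\Delta_G$ has one vertex per basic position (single-piece position), Left basic positions written $x_i$ and Right ones $y_j$, with a set of vertices a face iff the corresponding pieces together form a legal position; from the position corresponding to face $F$, Left (resp. Right) may move to $F\cup\{v\}$ for any Left (resp. Right) vertex $v\notin F$ with $F\cup\{v\}\in\Delta_G$. Every simplicial complex with vertices partitioned into Left and Right vertices is the legal complex of some SP-game. Integers as games: $0=\{\,\mid\,\}$, $n=\{n-1\mid\,\}$ for $n>0$. -}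

module Defs where

open import Level using (0ℓ) renaming (suc to lsuc)
open import Data.Nat using (ℕ; zero; suc; _+_; _≤_)
open import Data.Fin using (Fin)
open import Data.Fin.Subset using (Subset; _∈_; _∉_; _⊆_; _∪_; ⁅_⁆; ∣_∣)
  renaming (⊤ to full; ⊥ to empty)
open import Data.Empty using (⊥)
open import Data.Unit using (⊤; tt)
open import Data.Sum using (_⊎_; inj₁; inj₂; [_,_])
open import Data.Product using (Σ; ∃; _×_; _,_; proj₁)
open import Relation.Binary.PropositionalEquality using (_≡_)
open import Relation.Nullary using (Dec)

-- Combinatorial games (Conway-style: a set of Left options and a set of
-- Right options).  Option sets are arbitrary types; the games built
-- below are short (finitely many options, finite depth).

data Game : Set₁ where
  mk : (L : Set) → (L → Game) → (R : Set) → (R → Game) → Game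

-_ : Game → Game
- mk L gL R gR = mk R (λ r → - gR r) L (λ l → - gL l)

_⊕_ : Game → Game → Game
G@(mk L₁ gL₁ R₁ gR₁) ⊕ H@(mk L₂ gL₂ R₂ gR₂) =
  mk (L₁ ⊎ L₂) [ (λ i → gL₁ i ⊕ H) , (λ j → G ⊕ gL₂ j) ]
     (R₁ ⊎ R₂) [ (λ i → gR₁ i ⊕ H) , (λ j → G ⊕ gR₂ j) ]

mutual
  LeftWinsFirst : Game → Set
  LeftWinsFirst (mk L gL R gR) = Σ L λ i → LeftWinsSecond (gL i)

  LeftWinsSecond : Game → Set
  LeftWinsSecond (mk L gL R gR) = (j : R) → LeftWinsFirst (gR j)

mutual
  RightWinsFirst : Game → Set
  RightWinsFirst (mk L gL R gR) = Σ R λ j → RightWinsSecond (gR j)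

  RightWinsSecond : Game → Set
  RightWinsSecond (mk L gL R gR) = (i : L) → RightWinsFirst (gL i)

SecondPlayerWin : Game → Set
SecondPlayerWin G = LeftWinsSecond G × RightWinsSecond G

_≈_ : Game → Game → Set
G ≈ H = SecondPlayerWin (G ⊕ (- H))

intGame : ℕ → Game
intGame zero    = mk ⊥ (λ ()) ⊥ (λ ())
intGame (suc n) = mk ⊤ (λ _ → intGame n) ⊥ (λ ())

-- Simplicial complexes on a vertex set partitioned into
-- a Left vertices x₀ … x_{a-1} and b Right vertices y₀ … y_{b-1}.
-- A face is a pair (set of Left vertices, set of Right vertices).

Face : ℕ → ℕ → Set
Face a b = Subset a × Subset b

_⊆F_ : ∀ {a b} → Face a b → Face a b → Set
(S , T) ⊆F (S' , T') = (S ⊆ S') × (T ⊆ T')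

size : ∀ {a b} → Face a b → ℕ
size (S , T) = ∣ S ∣ + ∣ T ∣

record SimplicialComplex (a b : ℕ) : Set₁ where
  field
    face      : Face a b → Set
    face?     : (F : Face a b) → Dec (face F)
    downClosed : ∀ {F G} → face F → G ⊆F F → face G
open SimplicialComplex public

IsFacet : ∀ {a b} → SimplicialComplex a b → Face a b → Set
IsFacet Δ F = face Δ F × (∀ G → face Δ G → F ⊆F G → G ≡ F)

HasDimension : ∀ {a b} → SimplicialComplex a b → ℕ → Set
HasDimension Δ d =
  (Σ (Face _ _) λ F → face Δ F × size F ≡ suc d)
  × (∀ F → face Δ F → size F ≤ suc d)

-- The first argument is fuel; every move adds a new vertex, so fuel
-- a + b (the number of vertices) is never exhausted while moves exist.

gameFrom : ∀ {a b} → SimplicialComplex a b → ℕ → Face a b → Game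
gameFrom Δ zero    F = mk ⊥ (λ ()) ⊥ (λ ())
gameFrom {a} {b} Δ (suc f) (S , T) =
  mk (Σ (Fin a) λ x → x ∉ S × face Δ (S ∪ ⁅ x ⁆ , T))
     (λ o → gameFrom Δ f (S ∪ ⁅ proj₁ o ⁆ , T))
     (Σ (Fin b) λ y → y ∉ T × face Δ (S , T ∪ ⁅ y ⁆))
     (λ o → gameFrom Δ f (S , T ∪ ⁅ proj₁ o ⁆))

spGame : ∀ {a b} → SimplicialComplex a b → Game
spGame {a} {b} Δ = gameFrom Δ (a + b) (empty , empty)

-- The family U of the theorem, with Left vertices x₁ … x_{k+1}
-- (as Fin (suc k)) and one Right vertex y (as Fin 1):
--   {x₁,…,x_{k+1}}  and  {x_{i₀},…,x_{iₙ},y} for n+1 distinct x's.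

InU : (n k : ℕ) → Face (suc k) 1 → Set
InU n k (S , T) = (S ≡ full × T ≡ empty) ⊎ (∣ S ∣ ≡ suc n × T ≡ ⁅ Fin.zero ⁆)

-- Before Right's single vertex y is placed every set of Left vertices is legal, and once y is
-- placed exactly n + 1 Left vertices fit alongside it.  A board with i Left vertices and no y,
-- played against -j, is therefore a second-player win when i + j = n: Right answers a Left
-- vertex by moving in -j, or by placing y once j = 0, after which Left has no move; Left
-- answers a move in -j by a new Left vertex, and answers y by winning the remaining race of
-- n + 1 - i Left moves against j Right moves.  Hence the empty board has value n.  The
-- dimension k is that of the facet {x₁, …, x_{k+1}}, since the other facets have n + 2 ≤ k + 1
-- vertices.
module Submission where

open import Defs
open import Data.Nat using (ℕ; zero; suc; _+_; _∸_; _≤_; _<_; z≤n; s≤s)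
open import Data.Nat.Properties
  using (≤-refl; ≤-reflexive; ≤-trans; <⇒≱; 1+n≰n; +-suc; +-comm; +-identityʳ; +-mono-≤;
         +-monoˡ-≤; n≤1+n; m≤n+m; m+n≤o⇒m≤o; m<m+n; m+[n∸m]≡n; m≤n⇒∃[o]m+o≡n)
open import Data.Fin using (zero; suc)
open import Data.Fin.Properties using (any?; ¬∀⟶∃¬)
open import Data.Fin.Subset using (Subset; _∈_; _∉_; _⊆_; _∪_; ⁅_⁆; ∣_∣; inside; outside)
  renaming (⊤ to full; ⊥ to empty)
open import Data.Fin.Subset.Properties
  using (_∈?_; ∉⊥; ⊆⊤; ⊆-refl; ⊆-trans; ⊆-antisym; p⊆p∪q; x∈p∪q⁻; x∈⁅x⁆; x∈⁅y⁆⇒x≡y; ∪-identityʳ;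
         ∣p∣≤n; ∣⊤∣≡n; ∣⊥∣≡0; p⊆q⇒∣p∣≤∣q∣)
open import Data.Vec.Base using (_∷_; here; there)
open import Data.Empty using (⊥-elim)
open import Data.Unit using (tt)
open import Data.Sum using (_⊎_; inj₁; inj₂)
open import Data.Product using (Σ; ∃; _×_; _,_; proj₁)
open import Function using (_∘_)
open import Function.Bundles using (_⇔_; mk⇔; module Equivalence)
open import Relation.Binary.PropositionalEquality using (_≡_; refl; sym; trans; cong; cong₂; subst)
open import Relation.Nullary using (¬_; yes; no; ¬?)
open import Relation.Nullary.Decidable using (_×-dec_; decidable-stable)

x∉p⇒∣p∪⁅x⁆∣≡1+∣p∣ : ∀ {N} {p : Subset N} {x} → x ∉ p → ∣ p ∪ ⁅ x ⁆ ∣ ≡ suc ∣ p ∣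
x∉p⇒∣p∪⁅x⁆∣≡1+∣p∣ {p = inside  ∷ p} {zero}  x∉p = ⊥-elim (x∉p here)
x∉p⇒∣p∪⁅x⁆∣≡1+∣p∣ {p = outside ∷ p} {zero}  x∉p = cong (suc ∘ ∣_∣) (∪-identityʳ p)
x∉p⇒∣p∪⁅x⁆∣≡1+∣p∣ {p = inside  ∷ p} {suc x} x∉p = cong suc (x∉p⇒∣p∪⁅x⁆∣≡1+∣p∣ (x∉p ∘ there))
x∉p⇒∣p∪⁅x⁆∣≡1+∣p∣ {p = outside ∷ p} {suc x} x∉p = x∉p⇒∣p∪⁅x⁆∣≡1+∣p∣ (x∉p ∘ there)

x∉p⇒∣p∪⁅x⁆∣+n≡∣p∣+1+n : ∀ {N} {p : Subset N} {x} → x ∉ p → ∀ n → ∣ p ∪ ⁅ x ⁆ ∣ + n ≡ ∣ p ∣ + suc n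
x∉p⇒∣p∪⁅x⁆∣+n≡∣p∣+1+n {p = p} x∉p n = trans (cong (_+ n) (x∉p⇒∣p∪⁅x⁆∣≡1+∣p∣ x∉p)) (sym (+-suc ∣ p ∣ n))

∣p∣<n⇒∃∉ : ∀ {N} (p : Subset N) → ∣ p ∣ < N → ∃ λ x → x ∉ p
∣p∣<n⇒∃∉ {N} p ∣p∣<N = ¬∀⟶∃¬ N (_∈ p) (_∈? p) ¬all∈
  where
  ¬all∈ : ¬ (∀ x → x ∈ p)
  ¬all∈ all∈ = <⇒≱ ∣p∣<N (subst (_≤ ∣ p ∣) (∣⊤∣≡n N) (p⊆q⇒∣p∣≤∣q∣ {p = full} λ {x} _ → all∈ x))

∃⊇-ofSize : ∀ {N} (p : Subset N) j → ∣ p ∣ + j ≤ N → ∃ λ q → p ⊆ q × ∣ q ∣ ≡ ∣ p ∣ + j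
∃⊇-ofSize p zero    _    = p , ⊆-refl , sym (+-identityʳ ∣ p ∣)
∃⊇-ofSize {N} p (suc j) room =
  let x , x∉p          = ∣p∣<n⇒∃∉ p (≤-trans (m<m+n ∣ p ∣ (s≤s z≤n)) room)
      grown            = x∉p⇒∣p∪⁅x⁆∣+n≡∣p∣+1+n x∉p j
      q , p∪x⊆q , ∣q∣≡ = ∃⊇-ofSize (p ∪ ⁅ x ⁆) j (subst (_≤ N) (sym grown) room)
  in q , ⊆-trans (p⊆p∪q _) p∪x⊆q , trans ∣q∣≡ grown

∪⁅⁆⊆ : ∀ {N} {p q : Subset N} {x} → p ⊆ q → x ∈ q → p ∪ ⁅ x ⁆ ⊆ q
∪⁅⁆⊆ {p = p} {x = x} p⊆q x∈q {y} y∈p∪x with x∈p∪q⁻ p ⁅ x ⁆ y∈p∪x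
... | inj₁ y∈p = p⊆q y∈p
... | inj₂ y∈⁅x⁆ = subst (_∈ _) (sym (x∈⁅y⁆⇒x≡y x y∈⁅x⁆)) x∈q

LeftOption RightOption : Game → Set
LeftOption  (mk L _ _ _) = L
RightOption (mk _ _ R _) = R

leftOption : (G : Game) → LeftOption G → Game
leftOption (mk _ gL _ _) = gL

rightOption : (G : Game) → RightOption G → Game
rightOption (mk _ _ _ gR) = gR

leftWinsFirst-⊕ˡ : ∀ G H (i : LeftOption G) →
                   LeftWinsSecond (leftOption G i ⊕ H) → LeftWinsFirst (G ⊕ H)
leftWinsFirst-⊕ˡ (mk _ _ _ _) (mk _ _ _ _) i win = inj₁ i , win

rightWinsFirst-⊕ˡ : ∀ G H (j : RightOption G) →
                    RightWinsSecond (rightOption G j ⊕ H) → RightWinsFirst (G ⊕ H)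
rightWinsFirst-⊕ˡ (mk _ _ _ _) (mk _ _ _ _) j win = inj₁ j , win

rightWinsFirst-⊕ʳ : ∀ G H (j : RightOption H) →
                    RightWinsSecond (G ⊕ rightOption H j) → RightWinsFirst (G ⊕ H)
rightWinsFirst-⊕ʳ (mk _ _ _ _) (mk _ _ _ _) j win = inj₂ j , win

leftWinsSecond-⊕ : ∀ G H →
                   (∀ j → LeftWinsFirst (rightOption G j ⊕ H)) →
                   (∀ j → LeftWinsFirst (G ⊕ rightOption H j)) →
                   LeftWinsSecond (G ⊕ H)
leftWinsSecond-⊕ (mk _ _ _ _) (mk _ _ _ _) winˡ winʳ (inj₁ j) = winˡ j
leftWinsSecond-⊕ (mk _ _ _ _) (mk _ _ _ _) winˡ winʳ (inj₂ j) = winʳ j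

rightWinsSecond-⊕ : ∀ G H →
                    (∀ i → RightWinsFirst (leftOption G i ⊕ H)) →
                    (∀ i → RightWinsFirst (G ⊕ leftOption H i)) →
                    RightWinsSecond (G ⊕ H)
rightWinsSecond-⊕ (mk _ _ _ _) (mk _ _ _ _) winˡ winʳ (inj₁ i) = winˡ i
rightWinsSecond-⊕ (mk _ _ _ _) (mk _ _ _ _) winˡ winʳ (inj₂ i) = winʳ i

-intGame-noLeftOption : ∀ j → ¬ LeftOption (- intGame j)
-intGame-noLeftOption zero    ()
-intGame-noLeftOption (suc j) ()

⊆F-refl : ∀ {a b} {F : Face a b} → F ⊆F F
⊆F-refl = ⊆-refl , ⊆-refl

⊆F-trans : ∀ {a b} {F G H : Face a b} → F ⊆F G → G ⊆F H → F ⊆F H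
⊆F-trans (S⊆S' , T⊆T') (S'⊆S'' , T'⊆T'') = ⊆-trans S⊆S' S'⊆S'' , ⊆-trans T⊆T' T'⊆T''

size-mono : ∀ {a b} {F G : Face a b} → F ⊆F G → size F ≤ size G
size-mono (S⊆S' , T⊆T') = +-mono-≤ (p⊆q⇒∣p∣≤∣q∣ S⊆S') (p⊆q⇒∣p∣≤∣q∣ T⊆T')

size-full : ∀ k → size {suc k} {1} (full , empty) ≡ suc k
size-full k = trans (cong₂ _+_ (∣⊤∣≡n (suc k)) (∣⊥∣≡0 1)) (+-identityʳ (suc k))

size≤a+b : ∀ {a b} (F : Face a b) → size F ≤ a + b
size≤a+b (S , T) = +-mono-≤ (∣p∣≤n S) (∣p∣≤n T)

module _ {a b : ℕ} (Δ : SimplicialComplex a b) where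

  isFacet⊎extends : ∀ F → face Δ F →
                    IsFacet Δ F ⊎ Σ (Face a b) λ G → face Δ G × F ⊆F G × size F < size G
  isFacet⊎extends (S , T) fF
    with any? (λ x → ¬? (x ∈? S) ×-dec face? Δ (S ∪ ⁅ x ⁆ , T))
       | any? (λ y → ¬? (y ∈? T) ×-dec face? Δ (S , T ∪ ⁅ y ⁆))
  ... | yes (x , x∉S , fx) | _ =
    inj₂ (_ , fx , (p⊆p∪q _ , ⊆-refl) ,
          ≤-reflexive (cong (_+ ∣ T ∣) (sym (x∉p⇒∣p∪⁅x⁆∣≡1+∣p∣ x∉S))))
  ... | no _ | yes (y , y∉T , fy) =
    inj₂ (_ , fy , (⊆-refl , p⊆p∪q _) ,
          ≤-reflexive (sym (trans (cong (∣ S ∣ +_) (x∉p⇒∣p∪⁅x⁆∣≡1+∣p∣ y∉T)) (+-suc ∣ S ∣ ∣ T ∣))))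
  ... | no ¬left | no ¬right = inj₁ (fF , maximal)
    where
    maximal : ∀ G → face Δ G → (S , T) ⊆F G → G ≡ (S , T)
    maximal (S' , T') fG (S⊆S' , T⊆T') = cong₂ _,_ (⊆-antisym S'⊆S S⊆S') (⊆-antisym T'⊆T T⊆T')
      where
      S'⊆S : S' ⊆ S
      S'⊆S {x} x∈S' = decidable-stable (x ∈? S) λ x∉S →
        ¬left (x , x∉S , downClosed Δ fG (∪⁅⁆⊆ S⊆S' x∈S' , T⊆T'))
      T'⊆T : T' ⊆ T
      T'⊆T {y} y∈T' = decidable-stable (y ∈? T) λ y∉T →
        ¬right (y , y∉T , downClosed Δ fG (S⊆S' , ∪⁅⁆⊆ T⊆T' y∈T'))

  ⊆facet : ∀ d F → face Δ F → a + b ≤ size F + d → Σ (Face a b) λ G → IsFacet Δ G × F ⊆F G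
  ⊆facet d F fF room with isFacet⊎extends F fF | d
  ... | inj₁ isFacet | _ = F , isFacet , ⊆F-refl
  ... | inj₂ (G , _ , _ , F<G) | zero =
    ⊥-elim (<⇒≱ F<G (≤-trans (size≤a+b G) (subst (a + b ≤_) (+-identityʳ (size F)) room)))
  ... | inj₂ (G , fG , F⊆G , F<G) | suc d =
    let room′             = ≤-trans (≤-trans room (≤-reflexive (+-suc (size F) d))) (+-monoˡ-≤ d F<G)
        H , isFacet , G⊆H = ⊆facet d G fG room′
    in H , isFacet , ⊆F-trans F⊆G G⊆H

  face⇒⊆facet : ∀ {F} → face Δ F → Σ (Face a b) λ G → IsFacet Δ G × F ⊆F G
  face⇒⊆facet {F} fF = ⊆facet (a + b) F fF (m≤n+m (a + b) (size F))

module _ {n k : ℕ} (Δ : SimplicialComplex (suc k) 1) (n≤k : n ≤ k)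
         (face-withoutY : ∀ S → face Δ (S , empty))
         (face-withY⇔ : ∀ S → face Δ (S , ⁅ zero ⁆) ⇔ ∣ S ∣ ≤ suc n) where

  private
    Y : Subset 1
    Y = ⁅ zero ⁆

    fresh : ∀ S r → ∣ S ∣ + suc r ≡ suc n → ∃ λ x → x ∉ S
    fresh S r eq =
      ∣p∣<n⇒∃∉ S (≤-trans (≤-trans (m<m+n ∣ S ∣ (s≤s z≤n)) (≤-reflexive eq)) (s≤s n≤k))

    withY-noRightOption : ∀ f S → ¬ RightOption (gameFrom Δ f (S , Y))
    withY-noRightOption zero    S ()
    withY-noRightOption (suc f) S (zero , y∉Y , _) = y∉Y (x∈⁅x⁆ zero)

    withY-saturated : ∀ f S → ∣ S ∣ ≡ suc n → ¬ LeftOption (gameFrom Δ f (S , Y))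
    withY-saturated zero    S _ ()
    withY-saturated (suc f) S ∣S∣≡1+n (x , x∉S , fx) =
      1+n≰n (subst (_≤ suc n) (trans (x∉p⇒∣p∪⁅x⁆∣≡1+∣p∣ x∉S) (cong suc ∣S∣≡1+n))
                   (Equivalence.to (face-withY⇔ _) fx))

  -- Board r carries ∣ S ∣ + r ≡ suc n, so r more Left vertices still fit beside y.  Its fuel,
  -- r + m with y and one more without, makes every move land definitionally on a board of the
  -- same family; m is whatever fuel remains once the board is saturated.
  module Strategies (m : ℕ) where

    boardWithoutY boardWithY : ℕ → Subset (suc k) → Game
    boardWithoutY r S = gameFrom Δ (suc (r + m)) (S , empty)
    boardWithY    r S = gameFrom Δ (r + m) (S , Y)

    withY-leftFirst  : ∀ r S j → ∣ S ∣ + r ≡ suc n → j < r →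
                       LeftWinsFirst (boardWithY r S ⊕ (- intGame j))
    withY-leftSecond : ∀ r S j → ∣ S ∣ + r ≡ suc n → j ≤ r →
                       LeftWinsSecond (boardWithY r S ⊕ (- intGame j))

    withY-leftFirst (suc r) S j eq (s≤s j≤r) =
      let x , x∉S = fresh S r eq
          eq′     = trans (x∉p⇒∣p∪⁅x⁆∣+n≡∣p∣+1+n x∉S r) eq
          fx      = Equivalence.from (face-withY⇔ _) (m+n≤o⇒m≤o _ (≤-reflexive eq′))
      in leftWinsFirst-⊕ˡ (boardWithY (suc r) S) _ (x , x∉S , fx) (withY-leftSecond r _ j eq′ j≤r)

    withY-leftSecond r S zero _ _ =
      leftWinsSecond-⊕ (boardWithY r S) _ (⊥-elim ∘ withY-noRightOption (r + m) S) λ ()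
    withY-leftSecond r S (suc j) eq j<r =
      leftWinsSecond-⊕ (boardWithY r S) _ (⊥-elim ∘ withY-noRightOption (r + m) S) λ _ →
        withY-leftFirst r S j eq j<r

    placeY-leftFirst : ∀ j S → ∣ S ∣ + suc j ≡ suc n → ∀ o →
                       LeftWinsFirst (rightOption (boardWithoutY (suc j) S) o ⊕ (- intGame j))
    placeY-leftFirst j S eq (zero , _) = withY-leftFirst (suc j) S j eq ≤-refl

    withoutY-leftSecond : ∀ j S → ∣ S ∣ + suc j ≡ suc n →
                          LeftWinsSecond (boardWithoutY (suc j) S ⊕ (- intGame j))
    withoutY-leftSecond zero S eq =
      leftWinsSecond-⊕ (boardWithoutY 1 S) _ (placeY-leftFirst zero S eq) λ ()
    withoutY-leftSecond (suc j) S eq =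
      leftWinsSecond-⊕ (boardWithoutY (suc (suc j)) S) _ (placeY-leftFirst (suc j) S eq) λ _ →
        let x , x∉S = fresh S (suc j) eq
        in leftWinsFirst-⊕ˡ (boardWithoutY (suc (suc j)) S) _ (x , x∉S , face-withoutY _)
             (withoutY-leftSecond j _ (trans (x∉p⇒∣p∪⁅x⁆∣+n≡∣p∣+1+n x∉S (suc j)) eq))

    withY-rightSecond : ∀ S → ∣ S ∣ ≡ suc n → RightWinsSecond (boardWithY zero S ⊕ (- intGame zero))
    withY-rightSecond S ∣S∣≡1+n =
      rightWinsSecond-⊕ (boardWithY zero S) _ (⊥-elim ∘ withY-saturated m S ∣S∣≡1+n) λ ()

    withoutY-rightFirst  : ∀ j S → ∣ S ∣ + j ≡ suc n →
                           RightWinsFirst (boardWithoutY j S ⊕ (- intGame j))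
    withoutY-rightSecond : ∀ j S → ∣ S ∣ + suc j ≡ suc n →
                           RightWinsSecond (boardWithoutY (suc j) S ⊕ (- intGame j))

    withoutY-rightFirst zero S eq =
      let ∣S∣≡1+n = trans (sym (+-identityʳ ∣ S ∣)) eq
          fY      = Equivalence.from (face-withY⇔ S) (≤-reflexive ∣S∣≡1+n)
      in rightWinsFirst-⊕ˡ (boardWithoutY zero S) _ (zero , ∉⊥ , fY) (withY-rightSecond S ∣S∣≡1+n)
    withoutY-rightFirst (suc j) S eq =
      rightWinsFirst-⊕ʳ (boardWithoutY (suc j) S) _ tt (withoutY-rightSecond j S eq)

    withoutY-rightSecond j S eq =
      rightWinsSecond-⊕ (boardWithoutY (suc j) S) _
        (λ { (x , x∉S , _) →
               withoutY-rightFirst j _ (trans (x∉p⇒∣p∪⁅x⁆∣+n≡∣p∣+1+n x∉S j) eq) })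
        (⊥-elim ∘ -intGame-noLeftOption j)

  emptyBoard≈n : ∀ m → gameFrom Δ (suc (suc n + m)) (empty , empty) ≈ intGame n
  emptyBoard≈n m = withoutY-leftSecond n empty noneYet , withoutY-rightSecond n empty noneYet
    where
    open Strategies m
    noneYet : ∣ empty {suc k} ∣ + suc n ≡ suc n
    noneYet = cong (_+ suc n) (∣⊥∣≡0 (suc k))

module _ {n k : ℕ} (n<k : n < k) where

  InU⇒size≤1+k : ∀ {F} → InU n k F → size F ≤ suc k
  InU⇒size≤1+k (inj₁ (refl , refl)) = ≤-reflexive (size-full k)
  InU⇒size≤1+k (inj₂ (∣S∣≡1+n , refl)) =
    ≤-trans (≤-reflexive (cong (_+ 1) ∣S∣≡1+n)) (s≤s (subst (_≤ k) (+-comm 1 n) n<k))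

  module _ (Δ : SimplicialComplex (suc k) 1) (facets : ∀ F → IsFacet Δ F ⇔ InU n k F) where

    private
      facet : ∀ F → InU n k F → face Δ F
      facet F = proj₁ ∘ Equivalence.from (facets F)

    face-withoutY : ∀ S → face Δ (S , empty)
    face-withoutY S = downClosed Δ (facet _ (inj₁ (refl , refl))) (⊆⊤ , ⊆-refl)

    face-withY⇔ : ∀ S → face Δ (S , ⁅ zero ⁆) ⇔ ∣ S ∣ ≤ suc n
    face-withY⇔ S = mk⇔ to from
      where
      to : face Δ (S , ⁅ zero ⁆) → ∣ S ∣ ≤ suc n
      to fS with face⇒⊆facet Δ fS
      ... | G , isFacet , S⊆S' , Y⊆T' with Equivalence.to (facets G) isFacet
      ...   | inj₁ (refl , refl)    = ⊥-elim (∉⊥ (Y⊆T' (x∈⁅x⁆ zero)))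
      ...   | inj₂ (∣S'∣≡1+n , refl) = ≤-trans (p⊆q⇒∣p∣≤∣q∣ S⊆S') (≤-reflexive ∣S'∣≡1+n)
      from : ∣ S ∣ ≤ suc n → face Δ (S , ⁅ zero ⁆)
      from ∣S∣≤1+n =
        let j , ∣S∣+j≡1+n     = m≤n⇒∃[o]m+o≡n ∣S∣≤1+n
            room              = subst (_≤ suc k) (sym ∣S∣+j≡1+n) (≤-trans n<k (n≤1+n k))
            S' , S⊆S' , ∣S'∣≡ = ∃⊇-ofSize S j room
            fS'               = facet (S' , ⁅ zero ⁆) (inj₂ (trans ∣S'∣≡ ∣S∣+j≡1+n , refl))
        in downClosed Δ fS' (S⊆S' , ⊆-refl)

    hasDimension : HasDimension Δ k
    hasDimension = ((full , empty) , facet _ (inj₁ (refl , refl)) , size-full k) , size≤1+k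
      where
      size≤1+k : ∀ F → face Δ F → size F ≤ suc k
      size≤1+k F fF with face⇒⊆facet Δ fF
      ... | G , isFacet , F⊆G =
        ≤-trans (size-mono F⊆G) (InU⇒size≤1+k (Equivalence.to (facets G) isFacet))

mainTheorem6 : (n k : ℕ) → suc n ≤ k → (Δ : SimplicialComplex (suc k) 1)
    → (∀ F → IsFacet Δ F ⇔ InU n k F)
    → HasDimension Δ k × (spGame Δ ≈ intGame n)
mainTheorem6 n k n<k Δ facets =
  hasDimension n<k Δ facets ,
  subst (λ f → gameFrom Δ f (empty , empty) ≈ intGame n) fuel≡
        (emptyBoard≈n Δ n≤k (face-withoutY n<k Δ facets) (face-withY⇔ n<k Δ facets) (k ∸ n))
  where
  n≤k : n ≤ k
  n≤k = ≤-trans (n≤1+n n) n<k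
  fuel≡ : suc (suc n + (k ∸ n)) ≡ suc k + 1
  fuel≡ = cong suc (trans (cong suc (m+[n∸m]≡n n≤k)) (+-comm 1 k))
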